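{- Let $p$ be a prime number and let $f,g\in\mathbb{F}_p[x]$ be polynomials having no common root in $\mathbb{F}_p$. Then there exist $a,b\in\mathbb{F}_p$ such that the polynomial $af+bg$ has no root in $\mathbb{F}_p$. -}

module Defs where

open import Data.Nat using (ℕ; zero; suc; _+_; _*_; _<_)
open import Data.Nat.Divisibility using (_∣_)
open import Data.List using (List; []; _∷_; map)
open import Data.Product using (∃-syntax; _×_)

-- Polynomials over F_p are represented by their coefficient lists
-- (lowest degree first) with natural-number coefficients, read modulo p.
-- Elements of F_p are natural numbers x < p; equality in F_p is
-- congruence modulo p, so "h(x) = 0 in F_p" is  p ∣ eval h x.
Poly : Set
Poly = List ℕ

eval : Poly → ℕ → ℕ
eval []       x = 0
eval (c ∷ cs) x = c + x * eval cs x

_·ₚ_ : ℕ → Poly → Poly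
a ·ₚ f = map (a *_) f

_+ₚ_ : Poly → Poly → Poly
[]       +ₚ g        = g
(c ∷ cs) +ₚ []       = c ∷ cs
(c ∷ cs) +ₚ (d ∷ ds) = (c + d) ∷ (cs +ₚ ds)

IsRoot : ℕ → Poly → ℕ → Set
IsRoot p h x = p ∣ eval h x

HasRoot : ℕ → Poly → Set
HasRoot p h = ∃[ x ] (x < p × IsRoot p h x)

HasCommonRoot : ℕ → Poly → Poly → Set
HasCommonRoot p f g = ∃[ x ] (x < p × IsRoot p f x × IsRoot p g x)

module Submission where

-- Up to scaling, the pencil  { a·f + b·g }  over F_p has
-- exactly p + 1 members:  g  and  f + t·g  for t ∈ F_p.  If two distinct
-- members vanished at the same point x, then (since any two of them span
-- the pencil) f(x) = g(x) = 0, a common root.  So every point of F_p is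
-- a root of at most one member, and by the pigeonhole principle
-- (p + 1 members, p points) some member has no root at all.

open import Defs
open import Data.Nat using (ℕ; suc; _+_; _*_; _∸_; _<_; z<s)
open import Data.Nat.Base using (nonTrivial⇒n>1)
open import Data.Nat.Properties
open import Data.Nat.Divisibility using (_∣_; _∣?_; ∣m+n∣m⇒∣n; ∣n⇒∣m*n; ∣⇒≤)
open import Data.Nat.Primality using (Prime; prime; euclidsLemma)
open import Data.Nat.Solver using (module +-*-Solver)
open import Data.List using ([]; _∷_)
open import Data.Product using (∃-syntax; _×_; _,_; proj₁; proj₂)
open import Data.Sum using (inj₁; inj₂)
open import Data.Fin using (Fin; toℕ; fromℕ<) renaming (zero to fzero; suc to fsuc)
open import Data.Fin.Properties
  using (toℕ<n; toℕ-injective; toℕ-fromℕ<; any?; all?; ¬∀⟶∃¬; pigeonhole)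
open import Data.Empty using (⊥-elim)
open import Relation.Nullary using (¬_; Dec; yes; no)
open import Relation.Binary.PropositionalEquality
open import Relation.Binary.Definitions using (tri<; tri≈; tri>)
open +-*-Solver using (solve; _:+_; _:*_; _:=_)

eval-scale : ∀ a f x → eval (a ·ₚ f) x ≡ a * eval f x
eval-scale a []       x = sym (*-zeroʳ a)
eval-scale a (c ∷ cs) x rewrite eval-scale a cs x =
  solve 4 (λ a c x e → a :* c :+ x :* (a :* e) := a :* (c :+ x :* e))
    refl a c x (eval cs x)

eval-add : ∀ u v x → eval (u +ₚ v) x ≡ eval u x + eval v x
eval-add []       v        x = refl
eval-add (c ∷ cs) []       x = sym (+-identityʳ _)
eval-add (c ∷ cs) (d ∷ ds) x rewrite eval-add cs ds x =
  solve 5 (λ c d x e e' → (c :+ d) :+ x :* (e :+ e') := (c :+ x :* e) :+ (d :+ x :* e'))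
    refl c d x (eval cs x) (eval ds x)

eval-combination : ∀ a b f g x →
  eval ((a ·ₚ f) +ₚ (b ·ₚ g)) x ≡ a * eval f x + b * eval g x
eval-combination a b f g x
  rewrite eval-add (a ·ₚ f) (b ·ₚ g) x | eval-scale a f x | eval-scale b g x = refl

prime>1 : ∀ {p} → Prime p → 1 < p
prime>1 {p} (prime _) = nonTrivial⇒n>1 p

prime-cancel : ∀ {p k G} → Prime p → 0 < k → k < p → p ∣ k * G → p ∣ G
prime-cancel {k = suc k} {G} pp z<s k<p p∣kG with euclidsLemma (suc k) G pp p∣kG
... | inj₁ p∣k = ⊥-elim (<⇒≱ k<p (∣⇒≤ p∣k))
... | inj₂ p∣G = p∣G

-- If F + s·G and F + t·G both vanish mod p, with s < t < p, then G vanishes: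
-- their difference is the unit t − s times G.
two-lines-separate : ∀ {p F G s t} → Prime p → s < t → t < p →
  p ∣ F + s * G → p ∣ F + t * G → p ∣ G
two-lines-separate {p} {F} {G} {s} {t} pp s<t t<p p∣Fs p∣Ft =
  prime-cancel pp (m<n⇒0<n∸m s<t) (≤-<-trans (m∸n≤m t s) t<p)
    (∣m+n∣m⇒∣n (subst (p ∣_) split p∣Ft) p∣Fs)
  where
  open ≡-Reasoning
  split : F + t * G ≡ (F + s * G) + (t ∸ s) * G
  split = begin
    F + t * G             ≡⟨ cong (λ z → F + z * G) (sym (m+[n∸m]≡n (<⇒≤ s<t))) ⟩
    F + (s + (t ∸ s)) * G ≡⟨ cong (F +_) (*-distribʳ-+ G s (t ∸ s)) ⟩
    F + (s * G + (t ∸ s) * G) ≡⟨ sym (+-assoc F (s * G) ((t ∸ s) * G)) ⟩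
    (F + s * G) + (t ∸ s) * G ∎

line-recovers : ∀ {d F G} t → d ∣ G → d ∣ F + t * G → d ∣ F
line-recovers {d} {F} {G} t d∣G d∣F+tG =
  ∣m+n∣m⇒∣n (subst (d ∣_) (+-comm F (t * G)) d∣F+tG) (∣n⇒∣m*n t d∣G)

-- Coefficients (a, b) of the pencil members a·f + b·g, indexed by Fin (p + 1):
-- index fzero is g, index (fsuc t) is f + t·g.

coeffF : ∀ {p} → Fin (suc p) → ℕ
coeffF fzero    = 0
coeffF (fsuc _) = 1

coeffG : ∀ {p} → Fin (suc p) → ℕ
coeffG fzero    = 1
coeffG (fsuc t) = toℕ t

memberValue : ∀ {p} → Fin (suc p) → ℕ → ℕ → ℕ
memberValue fzero    F G = G
memberValue (fsuc t) F G = F + toℕ t * G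

memberValue-coeffs : ∀ {p} (c : Fin (suc p)) F G →
  coeffF c * F + coeffG c * G ≡ memberValue c F G
memberValue-coeffs fzero    F G = +-identityʳ G
memberValue-coeffs (fsuc t) F G = cong (_+ toℕ t * G) (*-identityˡ F)

coeffF<p : ∀ {p} → Prime p → (c : Fin (suc p)) → coeffF c < p
coeffF<p pp fzero    = <-trans z<s (prime>1 pp)
coeffF<p pp (fsuc _) = prime>1 pp

coeffG<p : ∀ {p} → Prime p → (c : Fin (suc p)) → coeffG c < p
coeffG<p pp fzero    = prime>1 pp
coeffG<p pp (fsuc t) = toℕ<n t

members-disjoint : ∀ {p F G} → Prime p → ¬ (p ∣ F × p ∣ G) →
  (c c' : Fin (suc p)) → p ∣ memberValue c F G → p ∣ memberValue c' F G → c ≡ c'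
members-disjoint pp nc fzero    fzero    _ _ = refl
members-disjoint pp nc fzero    (fsuc t) p∣G p∣Ft = ⊥-elim (nc (line-recovers (toℕ t) p∣G p∣Ft , p∣G))
members-disjoint pp nc (fsuc s) fzero    p∣Fs p∣G = ⊥-elim (nc (line-recovers (toℕ s) p∣G p∣Fs , p∣G))
members-disjoint pp nc (fsuc s) (fsuc t) p∣Fs p∣Ft with <-cmp (toℕ s) (toℕ t)
... | tri≈ _ s≡t _ = cong fsuc (toℕ-injective s≡t)
... | tri< s<t _ _ =
  let p∣G = two-lines-separate pp s<t (toℕ<n t) p∣Fs p∣Ft
  in ⊥-elim (nc (line-recovers (toℕ s) p∣G p∣Fs , p∣G))
... | tri> _ _ t<s =
  let p∣G = two-lines-separate pp t<s (toℕ<n s) p∣Ft p∣Fs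
  in ⊥-elim (nc (line-recovers (toℕ s) p∣G p∣Fs , p∣G))

empty-family : ∀ {n} (P : Fin (suc n) → Fin n → Set) → (∀ c i → Dec (P c i)) →
  (∀ c c' i → P c i → P c' i → c ≡ c') → ∃[ c ] (∀ i → ¬ P c i)
empty-family {n} P P? disjoint with all? (λ c → any? (P? c))
... | yes inhabited =
  let point = λ c → proj₁ (inhabited c)
      (c , c' , c<c' , same) = pigeonhole (n<1+n n) point
      c≡c' = disjoint c c' (point c') (subst (P c) same (proj₂ (inhabited c)))
                           (proj₂ (inhabited c'))
  in ⊥-elim (<-irrefl (cong toℕ c≡c') c<c')
... | no ¬inhabited =
  let (c , empty) = ¬∀⟶∃¬ (suc n) _ (λ c → any? (P? c)) ¬inhabited
  in c , λ i Pci → empty (i , Pci)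

no-root : ∀ {p} h → (∀ (i : Fin p) → ¬ IsRoot p h (toℕ i)) → ¬ HasRoot p h
no-root {p} h rootless (x , x<p , root) =
  rootless (fromℕ< x<p) (subst (IsRoot p h) (sym (toℕ-fromℕ< x<p)) root)

member : ∀ {p} → Poly → Poly → Fin (suc p) → Poly
member f g c = (coeffF c ·ₚ f) +ₚ (coeffG c ·ₚ g)

eval-member : ∀ {p} f g (c : Fin (suc p)) x →
  eval (member f g c) x ≡ memberValue c (eval f x) (eval g x)
eval-member f g c x = trans (eval-combination (coeffF c) (coeffG c) f g x)
                            (memberValue-coeffs c (eval f x) (eval g x))

rootless-member : ∀ {p} → Prime p → ∀ f g → ¬ HasCommonRoot p f g →
  ∃[ c ] ¬ HasRoot p (member {p} f g c)
rootless-member {p} pp f g noCommon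
  with empty-family Vanishes (λ c i → p ∣? eval (member f g c) (toℕ i)) disjoint
  where
  Vanishes : Fin (suc p) → Fin p → Set
  Vanishes c i = IsRoot p (member f g c) (toℕ i)

  disjoint : ∀ c c' i → Vanishes c i → Vanishes c' i → c ≡ c'
  disjoint c c' i root root' =
    members-disjoint pp (λ (p∣F , p∣G) → noCommon (toℕ i , toℕ<n i , p∣F , p∣G)) c c'
      (subst (p ∣_) (eval-member f g c (toℕ i)) root)
      (subst (p ∣_) (eval-member f g c' (toℕ i)) root')
... | c , rootless = c , no-root (member f g c) rootless

proposition2 : (p : ℕ) → Prime p → (f g : Poly) → ¬ HasCommonRoot p f g →
    ∃[ a ] ∃[ b ] (a < p × b < p × ¬ HasRoot p ((a ·ₚ f) +ₚ (b ·ₚ g)))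
proposition2 p pp f g noCommon with rootless-member pp f g noCommon
... | c , rootless = coeffF c , coeffG c , coeffF<p pp c , coeffG<p pp c , rootless
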